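{- Let $p\ge 11$ be a prime, let $\beta\in\mathbb{F}_{p^2}^*$ satisfy $\beta^{p-1}=-1$, and let $\gamma$ be a fixed primitive element of $\mathbb{F}_{p^2}$. Let $f:\mathbb{F}_{p^2}\to\mathbb{F}_{p^2}$ be a planar function such that $f(\lambda x)=\lambda^d f(x)$ for all $\lambda\in\mathbb{F}_p$, $x\in\mathbb{F}_{p^2}$ (for some fixed positive integer $d$), and such that $f(1)=1$, $f(\beta)=\beta^2$, $f(\gamma)=\gamma^2$. Then for $x\neq 0$, $\mathrm{Tr}(\beta f(x))=0$ if and only if $x\in\mathbb{F}_p^*\cup\beta\mathbb{F}_p^*$.
   Context: $\mathrm{Tr}$ denotes the trace from $\mathbb{F}_{p^2}$ to $\mathbb{F}_p$. A function $f:\mathbb{F}_q\to\mathbb{F}_q$ is planar if for every $a\in\mathbb{F}_q^*$ the map $x\mapsto f(x+a)-f(x)-f(a)$ is a permutation of $\mathbb{F}_q$. -}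

module Defs where

open import Data.Nat as ℕ using (ℕ; zero; suc; NonZero; _∸_)
open import Data.Nat.DivMod using (_mod_)
open import Data.Fin using (Fin; toℕ)
open import Data.Product using (_×_; _,_; Σ; ∃; proj₁; proj₂)
open import Relation.Binary.PropositionalEquality using (_≡_; _≢_)
open import Function.Definitions using (Bijective)

Fp : ℕ → Set
Fp p = Fin p

module _ {p : ℕ} .{{_ : NonZero p}} where

  0p : Fp p
  0p = 0 mod p

  1p : Fp p
  1p = 1 mod p

  _+p_ : Fp p → Fp p → Fp p
  a +p b = (toℕ a ℕ.+ toℕ b) mod p

  _*p_ : Fp p → Fp p → Fp p
  a *p b = (toℕ a ℕ.* toℕ b) mod p

  -p_ : Fp p → Fp p
  -p a = (p ∸ toℕ a) mod p

  NonSquare : Fp p → Set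
  NonSquare n = ∀ (x : Fp p) → x *p x ≢ n

-- The field F_{p^2}, modelled as F_p(√n) = { a + b √n } for a fixed
-- non-square n of F_p (p odd).  An element (a , b) stands for a + b √n.
Fp² : ℕ → Set
Fp² p = Fp p × Fp p

module _ {p : ℕ} .{{_ : NonZero p}} (n : Fp p) where

  0q : Fp² p
  0q = 0p , 0p

  1q : Fp² p
  1q = 1p , 0p

  ι : Fp p → Fp² p
  ι a = a , 0p

  _+q_ : Fp² p → Fp² p → Fp² p
  (a , b) +q (c , d) = (a +p c) , (b +p d)

  -q_ : Fp² p → Fp² p
  -q (a , b) = (-p a) , (-p b)

  _-q_ : Fp² p → Fp² p → Fp² p
  x -q y = x +q (-q y)

  _*q_ : Fp² p → Fp² p → Fp² p
  (a , b) *q (c , d) = ((a *p c) +p (n *p (b *p d))) , ((a *p d) +p (b *p c))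

  _^q_ : Fp² p → ℕ → Fp² p
  x ^q zero = 1q
  x ^q suc k = x *q (x ^q k)

  -- trace F_{p^2} → F_p : Tr(x) = x + x^p ; for x = a + b√n this is 2a
  Tr : Fp² p → Fp p
  Tr (a , b) = a +p a

  Primitive : Fp² p → Set
  Primitive γ = ∀ (x : Fp² p) → x ≢ 0q → ∃ λ (k : ℕ) → γ ^q k ≡ x

  Planar : (Fp² p → Fp² p) → Set
  Planar f = ∀ (a : Fp² p) → a ≢ 0q →
    Bijective _≡_ _≡_ (λ x → (f (x +q a) -q f x) -q f a)

  InFpStar : Fp² p → Set
  InFpStar x = Σ (Fp p) λ l → l ≢ 0p × x ≡ ι l

  InβFpStar : Fp² p → Fp² p → Set
  InβFpStar β x = Σ (Fp p) λ l → l ≢ 0p × x ≡ β *q ι l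

-- Write F_{p²} = F_p(√n).  Frobenius gives (a + b√n)^p = a + n^((p-1)/2) b√n, so β^(p-1) = -1
-- forces β = b√n, and then Tr(β f(x)) = 2nb·h(x) where h(x) is the √n-coordinate of f(x).
-- Homogeneity makes f(x) real on F_p and on βF_p, so h vanishes on both axes.  On the other
-- hand, by planarity h(x + a) - h(x) - h(a) takes every value exactly p times for a ≠ 0, so h has
-- p³ + p(p - 1) collisions; as its fibre sizes sum to p², Cauchy–Schwarz forces every fibre
-- to have fewer than 2p points.  The two axes already provide 2p - 1 zeros, hence there are
-- no others.

module Submission where

open import Defs
open import Algebra.Bundles using (CommutativeSemiring; CommutativeRing; Group)
open import Algebra.Structures using (IsCommutativeRing)
open import Algebra.Consequences.Propositional using (comm∧idˡ⇒id; comm∧invˡ⇒inv; comm∧distrˡ⇒distrʳ)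
open import Data.Bool using (if_then_else_)
open import Data.Empty using (⊥-elim)
open import Data.Fin as Fin using (Fin; zero; suc; toℕ; fromℕ; _↑ˡ_; _↑ʳ_; combine; remQuot)
open import Data.Fin.Patterns using (0F)
open import Data.Fin.Permutation using (Permutation; _⟨$⟩ʳ_)
open import Data.Fin.Properties
  using ( toℕ-injective; toℕ<n; toℕ-fromℕ<; fromℕ<-cong; inject₁ℕ<; toℕ-fromℕ
        ; remQuot-combine; combine-remQuot; *↔×)
open import Data.Nat as ℕ using (ℕ; zero; suc; NonZero; _∸_; _≤_; _<_; z≤n; s≤s; z<s; s<s; nonTrivial⇒n>1)
open import Data.Nat.Combinatorics using (_C_; nCk+nC[k+1]≡[n+1]C[k+1]; nC1≡n; k>n⇒nCk≡0; nCn≡1)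
open import Data.Nat.DivMod
  using (_mod_; _%_; _/_; m≡m%n+[m/n]*n; m<n⇒m%n≡m; %-distribˡ-+; %-distribˡ-*; m%n<n; [m+n]%n≡m%n)
open import Data.Nat.Divisibility using (_∣_; divides; m∣m*n; >⇒∤; ∣-refl; n∣m⇒m%n≡0; m%n≡0⇒n∣m)
open import Data.Nat.Primality using (Prime; euclidsLemma; prime⇒nonTrivial; prime⇒irreducible)
import Data.Nat.Properties as ℕ
open import Algebra.Properties.CommutativeMonoid.Sum ℕ.+-0-commutativeMonoid
  using (sum; sum-syntax; ∑-comm; ∑-distrib-+; sum-permute; sum-cong-≗; sum-remove)
open import Algebra.Properties.Semiring.Sum ℕ.+-*-semiring using (*-distribʳ-sum)
open import Data.Nat.Tactic.RingSolver using (solve-∀)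
open import Data.Product using (_×_; _,_; ∃; proj₁; proj₂; uncurry)
open import Data.Product.Properties using (≡-dec)
open import Data.Sum as Sum using (_⊎_; inj₁; inj₂)
open import Data.Vec.Functional using (Vector; init; removeAt)
open import Function using (_∘_; _⇔_; mk⇔; Equivalence; mk⤖)
open import Function.Construct.Composition using (_↔-∘_; _⇔-∘_)
open import Function.Construct.Symmetry using (↔-sym; ⇔-sym)
open import Function.Definitions using (Bijective)
open import Function.Properties.Bijection using (⤖⇒↔)
open import Level using (0ℓ)
open import Relation.Binary.PropositionalEquality
  using (_≡_; _≢_; refl; sym; trans; cong; cong₂; subst; subst₂; isEquivalence; module ≡-Reasoning)
open import Relation.Nullary using (Dec; yes; no; does; contradiction)

[k+1]*[n+1]C[k+1]≡[n+1]*nCk : ∀ n k → suc k ℕ.* (suc n C suc k) ≡ suc n ℕ.* (n C k)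
[k+1]*[n+1]C[k+1]≡[n+1]*nCk zero    zero    = refl
[k+1]*[n+1]C[k+1]≡[n+1]*nCk zero    (suc k) = begin
  suc (suc k) ℕ.* (1 C suc (suc k))  ≡⟨ cong (suc (suc k) ℕ.*_) (k>n⇒nCk≡0 {1} (s<s (z<s {k}))) ⟩
  suc (suc k) ℕ.* 0                  ≡⟨ ℕ.*-zeroʳ (suc (suc k)) ⟩
  0                                  ≡⟨ cong (1 ℕ.*_) (k>n⇒nCk≡0 {0} (z<s {k})) ⟨
  1 ℕ.* (0 C suc k)                  ∎
  where open ≡-Reasoning
[k+1]*[n+1]C[k+1]≡[n+1]*nCk (suc n) zero    =
  trans (ℕ.+-identityʳ _) (trans (nC1≡n (suc (suc n))) (sym (ℕ.*-identityʳ _)))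
[k+1]*[n+1]C[k+1]≡[n+1]*nCk (suc n) (suc k) = begin
  suc (suc k) ℕ.* (suc (suc n) C suc (suc k))
    ≡⟨ cong (suc (suc k) ℕ.*_) (nCk+nC[k+1]≡[n+1]C[k+1] (suc n) (suc k)) ⟨
  suc (suc k) ℕ.* (A ℕ.+ B)
    ≡⟨ regroup (suc k) A B ⟩
  A ℕ.+ (suc k ℕ.* A ℕ.+ suc (suc k) ℕ.* B)
    ≡⟨ cong₂ (λ u v → A ℕ.+ (u ℕ.+ v)) ([k+1]*[n+1]C[k+1]≡[n+1]*nCk n k) ([k+1]*[n+1]C[k+1]≡[n+1]*nCk n (suc k)) ⟩
  A ℕ.+ (suc n ℕ.* (n C k) ℕ.+ suc n ℕ.* (n C suc k))
    ≡⟨ cong (A ℕ.+_) (ℕ.*-distribˡ-+ (suc n) (n C k) _) ⟨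
  A ℕ.+ suc n ℕ.* (n C k ℕ.+ n C suc k)
    ≡⟨ cong (λ u → A ℕ.+ suc n ℕ.* u) (nCk+nC[k+1]≡[n+1]C[k+1] n k) ⟩
  A ℕ.+ suc n ℕ.* A
    ∎
  where
  open ≡-Reasoning
  A B : ℕ
  A = suc n C suc k
  B = suc n C suc (suc k)
  regroup : ∀ k a b → suc k ℕ.* (a ℕ.+ b) ≡ a ℕ.+ (k ℕ.* a ℕ.+ suc k ℕ.* b)
  regroup = solve-∀

prime∣pCk : ∀ {p k} → Prime p → 0 < k → k < p → p ∣ p C k
prime∣pCk {suc q} {suc j} p-prime _ k<p with euclidsLemma (suc j) (suc q C suc j) p-prime
  (subst (suc q ∣_) (sym ([k+1]*[n+1]C[k+1]≡[n+1]*nCk q j)) (m∣m*n (q C j)))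
... | inj₁ p∣k = contradiction p∣k (>⇒∤ k<p)
... | inj₂ p∣C = p∣C

prime>2⇒odd : ∀ {p} → Prime p → 2 < p → ∃ λ k → p ≡ suc (2 ℕ.* k)
prime>2⇒odd {p} p-prime 2<p with p % 2 in p%2≡ | m%n<n p 2 | m≡m%n+[m/n]*n p 2
... | 0           | _            | _  = ⊥-elim (Sum.[ (λ ()) , (λ 2≡p → ℕ.<-irrefl 2≡p 2<p) ]′
                                          (prime⇒irreducible p-prime (m%n≡0⇒n∣m p 2 p%2≡)))
... | 1           | _            | p≡ = p / 2 , trans p≡ (cong suc (ℕ.*-comm (p / 2) 2))
... | suc (suc _) | s<s (s<s ()) | _

module _ {c ℓ} (S : CommutativeSemiring c ℓ) where
  open CommutativeSemiring S hiding (refl; sym; trans)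
  open import Relation.Binary.Reasoning.Setoid setoid
  open import Algebra.Properties.Semiring.Mult semiring using (×-congʳ; ×-assoc-*; ×1-homo-*) renaming (_×_ to _·_)
  open import Algebra.Properties.Semiring.Exp semiring using (_^_)
  open import Algebra.Properties.CommutativeSemiring.Binomial S using (theorem; binomialTerm)
  import Algebra.Properties.Monoid.Sum +-monoid as ∑

  p∣m⇒m·x≈0 : ∀ {p m} → p · 1# ≈ 0# → ∀ x → p ∣ m → m · x ≈ 0#
  p∣m⇒m·x≈0 {p} {m} char x (divides q m≡qp) = begin
    m · x                        ≈⟨ ×-congʳ m (*-identityˡ x) ⟨
    m · (1# * x)                 ≈⟨ ×-assoc-* m 1# x ⟨
    (m · 1#) * x                 ≡⟨ cong (λ k → (k · 1#) * x) m≡qp ⟩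
    ((q ℕ.* p) · 1#) * x         ≈⟨ *-congʳ (×1-homo-* q p) ⟩
    ((q · 1#) * (p · 1#)) * x    ≈⟨ *-congʳ (*-congˡ char) ⟩
    ((q · 1#) * 0#) * x          ≈⟨ *-congʳ (zeroʳ _) ⟩
    0# * x                       ≈⟨ zeroˡ x ⟩
    0#                           ∎

  frobenius : ∀ {p} → Prime p → p · 1# ≈ 0# → ∀ x y → (x + y) ^ p ≈ x ^ p + y ^ p
  frobenius {suc q} p-prime char x y = begin
    (x + y) ^ suc q                                          ≈⟨ theorem (suc q) x y ⟩
    T 0F + ∑.sum (T ∘ suc)                                   ≈⟨ +-congˡ (∑.sum-init-last (T ∘ suc)) ⟩
    T 0F + (∑.sum (init (T ∘ suc)) + T (fromℕ (suc q)))      ≈⟨ +-congˡ (+-cong middle last) ⟩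
    T 0F + (0# + x ^ suc q)                                  ≈⟨ +-cong first (+-identityˡ _) ⟩
    y ^ suc q + x ^ suc q                                    ≈⟨ +-comm _ _ ⟩
    x ^ suc q + y ^ suc q                                    ∎
    where
    T : Fin (suc (suc q)) → Carrier
    T = binomialTerm x y (suc q)
    first : T 0F ≈ y ^ suc q
    first = begin
      1# * y ^ suc q + 0#  ≈⟨ +-identityʳ _ ⟩
      1# * y ^ suc q       ≈⟨ *-identityˡ _ ⟩
      y ^ suc q            ∎
    last : T (fromℕ (suc q)) ≈ x ^ suc q
    last = begin
      T (fromℕ (suc q))
        ≡⟨ cong (λ j → (suc q C j) · (x ^ j * y ^ (suc q ∸ j))) (toℕ-fromℕ (suc q)) ⟩
      (suc q C suc q) · (x ^ suc q * y ^ (suc q ∸ suc q))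
        ≡⟨ cong₂ (λ c e → c · (x ^ suc q * y ^ e)) (nCn≡1 (suc q)) (ℕ.n∸n≡0 q) ⟩
      x ^ suc q * 1# + 0#  ≈⟨ +-identityʳ _ ⟩
      x ^ suc q * 1#       ≈⟨ *-identityʳ _ ⟩
      x ^ suc q            ∎
    middle : ∑.sum (init (T ∘ suc)) ≈ 0#
    middle = begin
      ∑.sum (init (T ∘ suc))
        ≈⟨ ∑.sum-cong-≋ (λ i → p∣m⇒m·x≈0 char _ (prime∣pCk p-prime z<s (s<s (inject₁ℕ< i)))) ⟩
      ∑.sum {q} (λ _ → 0#)  ≈⟨ ∑.sum-replicate-zero q ⟩
      0#                    ∎

  1#^n≈1# : ∀ n → 1# ^ n ≈ 1#
  1#^n≈1# zero    = begin 1# ∎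
  1#^n≈1# (suc n) = begin
    1# * 1# ^ n  ≈⟨ *-identityˡ _ ⟩
    1# ^ n       ≈⟨ 1#^n≈1# n ⟩
    1#           ∎

  fermat : ∀ {p} → Prime p → p · 1# ≈ 0# → ∀ m → (m · 1#) ^ p ≈ m · 1#
  fermat {suc q} _       _    zero    = zeroˡ _
  fermat {p}     p-prime char (suc m) = begin
    (1# + m · 1#) ^ p        ≈⟨ frobenius p-prime char 1# (m · 1#) ⟩
    1# ^ p + (m · 1#) ^ p    ≈⟨ +-cong (1#^n≈1# p) (fermat p-prime char m) ⟩
    1# + m · 1#              ∎

module _ {a ℓ} (G : Group a ℓ) where
  open Group G hiding (refl; sym; trans)
  open import Algebra.Properties.Group G
    using (∙-cancelˡ; ∙-cancelʳ; \\-leftDividesˡ; x∙y⁻¹≈ε⇒x≈y; x≈y⇒x∙y⁻¹≈ε)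
  open import Relation.Binary.Reasoning.Setoid setoid

  ∙-translation-bijective : ∀ x → Bijective _≈_ _≈_ (x ∙_)
  ∙-translation-bijective x = ∙-cancelˡ x _ _ , λ y → x \\ y , λ {z} z≈x\\y → begin
    x ∙ z         ≈⟨ ∙-congˡ z≈x\\y ⟩
    x ∙ (x \\ y)  ≈⟨ \\-leftDividesˡ x y ⟩
    y             ∎

  [x∙y⁻¹]∙z⁻¹≈z⁻¹⇔x≈y : ∀ x y z → (x ∙ y ⁻¹) ∙ z ⁻¹ ≈ z ⁻¹ ⇔ x ≈ y
  [x∙y⁻¹]∙z⁻¹≈z⁻¹⇔x≈y x y z = mk⇔
    (λ eq → x∙y⁻¹≈ε⇒x≈y x y (∙-cancelʳ (z ⁻¹) _ _ (begin
      (x ∙ y ⁻¹) ∙ z ⁻¹  ≈⟨ eq ⟩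
      z ⁻¹               ≈⟨ identityˡ (z ⁻¹) ⟨
      ε ∙ z ⁻¹           ∎)))
    (λ x≈y → begin
      (x ∙ y ⁻¹) ∙ z ⁻¹  ≈⟨ ∙-congʳ (x≈y⇒x∙y⁻¹≈ε x≈y) ⟩
      ε ∙ z ⁻¹           ≈⟨ identityˡ (z ⁻¹) ⟩
      z ⁻¹               ∎)

module _ {p : ℕ} .{{_ : NonZero p}} where
  open ≡-Reasoning

  mod-cong : ∀ {m n} → m % p ≡ n % p → m mod p ≡ n mod p
  mod-cong {m} {n} eq = fromℕ<-cong _ _ eq (m%n<n m p) (m%n<n n p)

  toℕ-mod : ∀ m → toℕ (m mod p) ≡ m % p
  toℕ-mod m = toℕ-fromℕ< (m%n<n m p)

  mod-toℕ : ∀ (a : Fp p) → toℕ a mod p ≡ a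
  mod-toℕ a = toℕ-injective (trans (toℕ-mod (toℕ a)) (m<n⇒m%n≡m (toℕ<n a)))

  mod-+ : ∀ m n → (m ℕ.+ n) mod p ≡ (m mod p) +p (n mod p)
  mod-+ m n = mod-cong (begin
    (m ℕ.+ n) % p ≡⟨ %-distribˡ-+ m n p ⟩
    (m % p ℕ.+ n % p) % p ≡⟨ cong₂ (λ x y → (x ℕ.+ y) % p) (toℕ-mod m) (toℕ-mod n) ⟨
    (toℕ (m mod p) ℕ.+ toℕ (n mod p)) % p ∎)

  mod-* : ∀ m n → (m ℕ.* n) mod p ≡ (m mod p) *p (n mod p)
  mod-* m n = mod-cong (begin
    (m ℕ.* n) % p ≡⟨ %-distribˡ-* m n p ⟩
    (m % p ℕ.* (n % p)) % p ≡⟨ cong₂ (λ x y → (x ℕ.* y) % p) (toℕ-mod m) (toℕ-mod n) ⟨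
    (toℕ (m mod p) ℕ.* toℕ (n mod p)) % p ∎)

  mod-+ˡ : ∀ m a → (m ℕ.+ toℕ a) mod p ≡ (m mod p) +p a
  mod-+ˡ m a = trans (mod-+ m (toℕ a)) (cong ((m mod p) +p_) (mod-toℕ a))

  mod-+ʳ : ∀ a m → (toℕ a ℕ.+ m) mod p ≡ a +p (m mod p)
  mod-+ʳ a m = trans (mod-+ (toℕ a) m) (cong (_+p (m mod p)) (mod-toℕ a))

  mod-*ˡ : ∀ m a → (m ℕ.* toℕ a) mod p ≡ (m mod p) *p a
  mod-*ˡ m a = trans (mod-* m (toℕ a)) (cong ((m mod p) *p_) (mod-toℕ a))

  mod-*ʳ : ∀ a m → (toℕ a ℕ.* m) mod p ≡ a *p (m mod p)
  mod-*ʳ a m = trans (mod-* (toℕ a) m) (cong (_*p (m mod p)) (mod-toℕ a))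

  +p-assoc : ∀ a b c → (a +p b) +p c ≡ a +p (b +p c)
  +p-assoc a b c = begin
    (a +p b) +p c                    ≡⟨ mod-+ˡ (toℕ a ℕ.+ toℕ b) c ⟨
    (toℕ a ℕ.+ toℕ b ℕ.+ toℕ c) mod p   ≡⟨ cong (_mod p) (ℕ.+-assoc (toℕ a) (toℕ b) (toℕ c)) ⟩
    (toℕ a ℕ.+ (toℕ b ℕ.+ toℕ c)) mod p ≡⟨ mod-+ʳ a (toℕ b ℕ.+ toℕ c) ⟩
    a +p (b +p c)                    ∎

  +p-comm : ∀ a b → a +p b ≡ b +p a
  +p-comm a b = cong (_mod p) (ℕ.+-comm (toℕ a) (toℕ b))

  +p-identityˡ : ∀ a → 0p +p a ≡ a
  +p-identityˡ a = trans (sym (mod-+ˡ 0 a)) (mod-toℕ a)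

  -p-inverseˡ : ∀ a → (-p a) +p a ≡ 0p
  -p-inverseˡ a = begin
    (-p a) +p a                 ≡⟨ mod-+ˡ (p ∸ toℕ a) a ⟨
    (p ∸ toℕ a ℕ.+ toℕ a) mod p ≡⟨ cong (_mod p) (ℕ.m∸n+n≡m (ℕ.<⇒≤ (toℕ<n a))) ⟩
    p mod p                     ≡⟨ mod-cong ([m+n]%n≡m%n 0 p) ⟩
    0p                          ∎

  *p-assoc : ∀ a b c → (a *p b) *p c ≡ a *p (b *p c)
  *p-assoc a b c = begin
    (a *p b) *p c                       ≡⟨ mod-*ˡ (toℕ a ℕ.* toℕ b) c ⟨
    (toℕ a ℕ.* toℕ b ℕ.* toℕ c) mod p   ≡⟨ cong (_mod p) (ℕ.*-assoc (toℕ a) (toℕ b) (toℕ c)) ⟩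
    (toℕ a ℕ.* (toℕ b ℕ.* toℕ c)) mod p ≡⟨ mod-*ʳ a (toℕ b ℕ.* toℕ c) ⟩
    a *p (b *p c)                       ∎

  *p-comm : ∀ a b → a *p b ≡ b *p a
  *p-comm a b = cong (_mod p) (ℕ.*-comm (toℕ a) (toℕ b))

  *p-identityˡ : ∀ a → 1p *p a ≡ a
  *p-identityˡ a = trans (sym (mod-*ˡ 1 a)) (trans (cong (_mod p) (ℕ.*-identityˡ (toℕ a))) (mod-toℕ a))

  *p-distribˡ-+p : ∀ a b c → a *p (b +p c) ≡ (a *p b) +p (a *p c)
  *p-distribˡ-+p a b c = begin
    a *p (b +p c)                                 ≡⟨ mod-*ʳ a (toℕ b ℕ.+ toℕ c) ⟨
    (toℕ a ℕ.* (toℕ b ℕ.+ toℕ c)) mod p           ≡⟨ cong (_mod p) (ℕ.*-distribˡ-+ (toℕ a) (toℕ b) (toℕ c)) ⟩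
    (toℕ a ℕ.* toℕ b ℕ.+ toℕ a ℕ.* toℕ c) mod p   ≡⟨ mod-+ (toℕ a ℕ.* toℕ b) (toℕ a ℕ.* toℕ c) ⟩
    (a *p b) +p (a *p c)                          ∎

  Fp-isCommutativeRing : IsCommutativeRing _≡_ _+p_ _*p_ -p_ 0p 1p
  Fp-isCommutativeRing = record
    { isRing = record
      { +-isAbelianGroup = record
        { isGroup = record
          { isMonoid = record
            { isSemigroup = record
              { isMagma = record { isEquivalence = isEquivalence ; ∙-cong = cong₂ _+p_ }
              ; assoc = +p-assoc }
            ; identity = comm∧idˡ⇒id +p-comm +p-identityˡ }
          ; inverse = comm∧invˡ⇒inv +p-comm -p-inverseˡ
          ; ⁻¹-cong = cong -p_ }
        ; comm = +p-comm }
      ; *-cong = cong₂ _*p_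
      ; *-assoc = *p-assoc
      ; *-identity = comm∧idˡ⇒id *p-comm *p-identityˡ
      ; distrib = *p-distribˡ-+p , comm∧distrˡ⇒distrʳ *p-comm *p-distribˡ-+p }
    ; *-comm = *p-comm }

  Fp-commutativeRing : CommutativeRing 0ℓ 0ℓ
  Fp-commutativeRing = record { isCommutativeRing = Fp-isCommutativeRing }

  open CommutativeRing Fp-commutativeRing using (commutativeSemiring; semiring; ring; +-group; -‿inverseʳ; *-identityʳ; zeroˡ)
  open import Algebra.Properties.Semiring.Mult semiring public using () renaming (_×_ to _×p_)
  open import Algebra.Properties.Semiring.Exp semiring public using () renaming (_^_ to _^p_)
  open import Algebra.Properties.Ring ring using (x[y-z]≈xy-xz)
  open import Algebra.Properties.Group +-group using (x∙y⁻¹≈ε⇒x≈y)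

  0%p≡0 : 0 % p ≡ 0
  0%p≡0 = m<n⇒m%n≡m (ℕ.>-nonZero⁻¹ p)

  p∣⇒mod≡0p : ∀ m → p ∣ m → m mod p ≡ 0p
  p∣⇒mod≡0p m p∣m = mod-cong (trans (n∣m⇒m%n≡0 m p p∣m) (sym 0%p≡0))

  mod≡0p⇒p∣ : ∀ m → m mod p ≡ 0p → p ∣ m
  mod≡0p⇒p∣ m eq = m%n≡0⇒n∣m m p (begin
    m % p          ≡⟨ toℕ-mod m ⟨
    toℕ (m mod p)  ≡⟨ cong toℕ eq ⟩
    toℕ (0 mod p)  ≡⟨ toℕ-mod 0 ⟩
    0 % p          ≡⟨ 0%p≡0 ⟩
    0              ∎)

  ×p-1p : ∀ m → m ×p 1p ≡ m mod p
  ×p-1p zero    = refl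
  ×p-1p (suc m) = trans (cong (1p +p_) (×p-1p m)) (sym (mod-+ 1 m))

  Fp-char : p ×p 1p ≡ 0p
  Fp-char = trans (×p-1p p) (p∣⇒mod≡0p p ∣-refl)

  ^p-fermat : Prime p → ∀ a → a ^p p ≡ a
  ^p-fermat p-prime a = begin
    a ^p p                ≡⟨ cong (_^p p) a≡[a]×1 ⟩
    (toℕ a ×p 1p) ^p p    ≡⟨ fermat commutativeSemiring p-prime Fp-char (toℕ a) ⟩
    toℕ a ×p 1p           ≡⟨ a≡[a]×1 ⟨
    a                     ∎
    where
    a≡[a]×1 : a ≡ toℕ a ×p 1p
    a≡[a]×1 = trans (sym (mod-toℕ a)) (sym (×p-1p (toℕ a)))

  a*b≡0⇒a≡0∨b≡0 : Prime p → ∀ {a b} → a *p b ≡ 0p → a ≡ 0p ⊎ b ≡ 0p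
  a*b≡0⇒a≡0∨b≡0 p-prime {a} {b} ab≡0 =
    Sum.map (p∣toℕ⇒≡0p a) (p∣toℕ⇒≡0p b) (euclidsLemma (toℕ a) (toℕ b) p-prime (mod≡0p⇒p∣ _ ab≡0))
    where
    p∣toℕ⇒≡0p : ∀ a → p ∣ toℕ a → a ≡ 0p
    p∣toℕ⇒≡0p a p∣a = trans (sym (mod-toℕ a)) (p∣⇒mod≡0p (toℕ a) p∣a)

  *p-cancelˡ : Prime p → ∀ {a b c} → a ≢ 0p → a *p b ≡ a *p c → b ≡ c
  *p-cancelˡ p-prime {a} {b} {c} a≢0 ab≡ac with a*b≡0⇒a≡0∨b≡0 p-prime a[b-c]≡0
    where
    a[b-c]≡0 : a *p (b +p (-p c)) ≡ 0p
    a[b-c]≡0 = begin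
      a *p (b +p (-p c))              ≡⟨ x[y-z]≈xy-xz a b c ⟩
      (a *p b) +p (-p (a *p c))       ≡⟨ cong (λ x → x +p (-p (a *p c))) ab≡ac ⟩
      (a *p c) +p (-p (a *p c))       ≡⟨ -‿inverseʳ (a *p c) ⟩
      0p                              ∎
  ... | inj₁ a≡0     = contradiction a≡0 a≢0
  ... | inj₂ b-c≡0   = x∙y⁻¹≈ε⇒x≈y b c b-c≡0

  *p-inverse : Prime p → ∀ {a} → a ≢ 0p → ∃ λ a⁻¹ → a *p a⁻¹ ≡ 1p
  *p-inverse p-prime {a} a≢0 = a ^p (p ∸ 2) , *p-cancelˡ p-prime a≢0 (begin
    a *p (a *p (a ^p (p ∸ 2))) ≡⟨ cong (a ^p_) (ℕ.m+[n∸m]≡n 2≤p) ⟩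
    a ^p p                    ≡⟨ ^p-fermat p-prime a ⟩
    a                         ≡⟨ *-identityʳ a ⟨
    a *p 1p                   ∎)
    where
    2≤p : 2 ≤ p
    2≤p = nonTrivial⇒n>1 p {{prime⇒nonTrivial p-prime}}

  a+a≡0⇒a≡0 : Prime p → 2 < p → ∀ {a} → a +p a ≡ 0p → a ≡ 0p
  a+a≡0⇒a≡0 p-prime 2<p {a} a+a≡0 with a*b≡0⇒a≡0∨b≡0 p-prime 2a≡0
    where
    2a≡0 : (2 mod p) *p a ≡ 0p
    2a≡0 = begin
      (2 mod p) *p a              ≡⟨ mod-*ˡ 2 a ⟨
      (2 ℕ.* toℕ a) mod p         ≡⟨ cong (λ m → (toℕ a ℕ.+ m) mod p) (ℕ.+-identityʳ (toℕ a)) ⟩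
      a +p a                      ≡⟨ a+a≡0 ⟩
      0p                          ∎
  ... | inj₁ 2≡0 = contradiction (mod≡0p⇒p∣ 2 2≡0) (>⇒∤ 2<p)
  ... | inj₂ a≡0 = a≡0

  nonSquare⇒≢0 : ∀ {n} → NonSquare n → n ≢ 0p
  nonSquare⇒≢0 {n} nsq n≡0 = nsq 0p (trans (zeroˡ 0p) (sym n≡0))

module _ {p : ℕ} .{{_ : NonZero p}} (n : Fp p) where
  open CommutativeRing (Fp-commutativeRing {p}) using (commutativeSemiring; zeroˡ; zeroʳ; +-identityʳ)
  open import Algebra.Solver.Ring.NaturalCoefficients.Default commutativeSemiring

  +q-assoc : ∀ x y z → _+q_ n (_+q_ n x y) z ≡ _+q_ n x (_+q_ n y z)
  +q-assoc (a , b) (c , d) (e , f) = cong₂ _,_ (+p-assoc a c e) (+p-assoc b d f)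

  +q-comm : ∀ x y → _+q_ n x y ≡ _+q_ n y x
  +q-comm (a , b) (c , d) = cong₂ _,_ (+p-comm a c) (+p-comm b d)

  +q-identityˡ : ∀ x → _+q_ n (0q n) x ≡ x
  +q-identityˡ (a , b) = cong₂ _,_ (+p-identityˡ a) (+p-identityˡ b)

  -q-inverseˡ : ∀ x → _+q_ n (-q_ n x) x ≡ 0q n
  -q-inverseˡ (a , b) = cong₂ _,_ (-p-inverseˡ a) (-p-inverseˡ b)

  *q-assoc : ∀ x y z → _*q_ n (_*q_ n x y) z ≡ _*q_ n x (_*q_ n y z)
  *q-assoc (a , b) (c , d) (e , f) = cong₂ _,_
    (solve 7 (λ a b c d e f n →
      (a :* c :+ n :* (b :* d)) :* e :+ n :* ((a :* d :+ b :* c) :* f)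
        := a :* (c :* e :+ n :* (d :* f)) :+ n :* (b :* (c :* f :+ d :* e))) refl a b c d e f n)
    (solve 7 (λ a b c d e f n →
      (a :* c :+ n :* (b :* d)) :* f :+ (a :* d :+ b :* c) :* e
        := a :* (c :* f :+ d :* e) :+ b :* (c :* e :+ n :* (d :* f))) refl a b c d e f n)

  *q-comm : ∀ x y → _*q_ n x y ≡ _*q_ n y x
  *q-comm (a , b) (c , d) = cong₂ _,_
    (cong₂ _+p_ (*p-comm a c) (cong (n *p_) (*p-comm b d)))
    (trans (+p-comm (a *p d) (b *p c)) (cong₂ _+p_ (*p-comm b c) (*p-comm a d)))

  *q-identityˡ : ∀ x → _*q_ n (1q n) x ≡ x
  *q-identityˡ (a , b) = cong₂ _,_
    (trans (cong₂ _+p_ (*p-identityˡ a) (trans (cong (n *p_) (zeroˡ b)) (zeroʳ n))) (+-identityʳ a))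
    (trans (cong₂ _+p_ (*p-identityˡ b) (zeroˡ a)) (+-identityʳ b))

  *q-distribˡ-+q : ∀ x y z → _*q_ n x (_+q_ n y z) ≡ _+q_ n (_*q_ n x y) (_*q_ n x z)
  *q-distribˡ-+q (a , b) (c , d) (e , f) = cong₂ _,_
    (solve 7 (λ a b c d e f n →
      a :* (c :+ e) :+ n :* (b :* (d :+ f))
        := (a :* c :+ n :* (b :* d)) :+ (a :* e :+ n :* (b :* f))) refl a b c d e f n)
    (solve 6 (λ a b c d e f →
      a :* (d :+ f) :+ b :* (c :+ e)
        := (a :* d :+ b :* c) :+ (a :* f :+ b :* e)) refl a b c d e f)

  Fp²-isCommutativeRing : IsCommutativeRing _≡_ (_+q_ n) (_*q_ n) (-q_ n) (0q n) (1q n)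
  Fp²-isCommutativeRing = record
    { isRing = record
      { +-isAbelianGroup = record
        { isGroup = record
          { isMonoid = record
            { isSemigroup = record
              { isMagma = record { isEquivalence = isEquivalence ; ∙-cong = cong₂ (_+q_ n) }
              ; assoc = +q-assoc }
            ; identity = comm∧idˡ⇒id +q-comm +q-identityˡ }
          ; inverse = comm∧invˡ⇒inv +q-comm -q-inverseˡ
          ; ⁻¹-cong = cong (-q_ n) }
        ; comm = +q-comm }
      ; *-cong = cong₂ (_*q_ n)
      ; *-assoc = *q-assoc
      ; *-identity = comm∧idˡ⇒id *q-comm *q-identityˡ
      ; distrib = *q-distribˡ-+q , comm∧distrˡ⇒distrʳ *q-comm *q-distribˡ-+q }
    ; *-comm = *q-comm }

  Fp²-commutativeRing : CommutativeRing 0ℓ 0ℓ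
  Fp²-commutativeRing = record { isCommutativeRing = Fp²-isCommutativeRing }

module _ {p : ℕ} .{{_ : NonZero p}} (n : Fp p) where
  open CommutativeRing (Fp-commutativeRing {p}) using ()
    renaming (zeroˡ to *p-zeroˡ; zeroʳ to *p-zeroʳ; +-identityʳ to +p-identityʳ; *-identityʳ to *p-identityʳ)
  open CommutativeRing (Fp²-commutativeRing n) hiding (refl; sym; trans; reflexive; isEquivalence)
  open import Algebra.Properties.Semiring.Mult semiring using () renaming (_×_ to _×q_)
  open import Algebra.Properties.Semiring.Exp semiring using (_^_; ^-assocʳ)
  open import Algebra.Properties.CommutativeSemiring.Exp commutativeSemiring using (^-distrib-*)
  open import Algebra.Properties.Ring ring using (-1*x≈-x)
  open ≡-Reasoning

  ι-+ : ∀ a b → ι n (a +p b) ≡ ι n a + ι n b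
  ι-+ a b = cong (a +p b ,_) (sym (+p-identityˡ 0p))

  ι-* : ∀ a b → ι n (a *p b) ≡ ι n a * ι n b
  ι-* a b = sym (cong₂ _,_
    (trans (cong ((a *p b) +p_) (trans (cong (n *p_) (*p-zeroˡ 0p)) (*p-zeroʳ n))) (+p-identityʳ (a *p b)))
    (trans (cong₂ _+p_ (*p-zeroʳ a) (*p-zeroˡ b)) (+p-identityˡ 0p)))

  ι-^ : ∀ a k → ι n (a ^p k) ≡ ι n a ^ k
  ι-^ a zero    = refl
  ι-^ a (suc k) = trans (ι-* a (a ^p k)) (cong (ι n a *_) (ι-^ a k))

  ×q-1#≡ι : ∀ m → m ×q 1# ≡ ι n (m ×p 1p)
  ×q-1#≡ι zero    = refl
  ×q-1#≡ι (suc m) = trans (cong (1# +_) (×q-1#≡ι m)) (sym (ι-+ 1p (m ×p 1p)))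

  Fp²-char : p ×q 1# ≡ 0#
  Fp²-char = trans (×q-1#≡ι p) (cong (ι n) Fp-char)

  ι-fermat : Prime p → ∀ a → ι n a ^ p ≡ ι n a
  ι-fermat p-prime a = trans (sym (ι-^ a p)) (cong (ι n) (^p-fermat p-prime a))

  √n : Fp² p
  √n = 0p , 1p

  [0,b]*ι[l]≡[0,bl] : ∀ b l → (0p , b) * ι n l ≡ (0p , b *p l)
  [0,b]*ι[l]≡[0,bl] b l = cong₂ _,_
    (trans (cong₂ _+p_ (*p-zeroˡ l) (trans (cong (n *p_) (*p-zeroʳ b)) (*p-zeroʳ n))) (+p-identityˡ 0p))
    (trans (cong (_+p (b *p l)) (*p-zeroˡ 0p)) (+p-identityˡ (b *p l)))

  √n*ι : ∀ b → √n * ι n b ≡ (0p , b)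
  √n*ι b = trans ([0,b]*ι[l]≡[0,bl] 1p b) (cong (0p ,_) (*p-identityˡ b))

  ι+√n*ι : ∀ a b → ι n a + √n * ι n b ≡ (a , b)
  ι+√n*ι a b = trans (cong (ι n a +_) (√n*ι b)) (cong₂ _,_ (+p-identityʳ a) (+p-identityˡ b))

  √n^2 : √n ^ 2 ≡ ι n n
  √n^2 = trans (cong (√n *_) (*-identityʳ √n)) (cong₂ _,_
    (trans (cong₂ _+p_ (*p-zeroˡ 0p) (trans (cong (n *p_) (*p-identityˡ 1p)) (*p-identityʳ n))) (+p-identityˡ n))
    (trans (cong₂ _+p_ (*p-zeroˡ 1p) (*p-zeroʳ 1p)) (+p-identityˡ 0p)))

  √n^[2k+1] : ∀ k → √n ^ suc (2 ℕ.* k) ≡ √n * ι n (n ^p k)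
  √n^[2k+1] k = cong (√n *_) (begin
    √n ^ (2 ℕ.* k)   ≡⟨ ^-assocʳ √n 2 k ⟨
    (√n ^ 2) ^ k     ≡⟨ cong (_^ k) √n^2 ⟩
    ι n n ^ k        ≡⟨ ι-^ n k ⟨
    ι n (n ^p k)     ∎)

  frobenius-Fp² : Prime p → ∀ {k} → p ≡ suc (2 ℕ.* k) → ∀ a b → (a , b) ^ p ≡ (a , (n ^p k) *p b)
  frobenius-Fp² p-prime {k} p≡2k+1 a b = begin
    (a , b) ^ p
      ≡⟨ cong (_^ p) (ι+√n*ι a b) ⟨
    (ι n a + √n * ι n b) ^ p
      ≡⟨ frobenius commutativeSemiring p-prime Fp²-char (ι n a) (√n * ι n b) ⟩
    ι n a ^ p + (√n * ι n b) ^ p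
      ≡⟨ cong₂ _+_ (ι-fermat p-prime a) (^-distrib-* √n (ι n b) p) ⟩
    ι n a + √n ^ p * ι n b ^ p
      ≡⟨ cong₂ (λ x y → ι n a + x * y) (trans (cong (√n ^_) p≡2k+1) (√n^[2k+1] k)) (ι-fermat p-prime b) ⟩
    ι n a + √n * ι n (n ^p k) * ι n b
      ≡⟨ cong (ι n a +_) (trans (*-assoc √n _ _) (cong (√n *_) (sym (ι-* (n ^p k) b)))) ⟩
    ι n a + √n * ι n ((n ^p k) *p b)
      ≡⟨ ι+√n*ι a ((n ^p k) *p b) ⟩
    (a , (n ^p k) *p b)
      ∎

  ^q≡^ : ∀ x k → _^q_ n x k ≡ x ^ k
  ^q≡^ x zero    = refl
  ^q≡^ x (suc k) = cong (x *_) (^q≡^ x k)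

  ^[p-1]≡-1⇒re≡0 : Prime p → 2 < p → ∀ {a b} → _^q_ n (a , b) (p ∸ 1) ≡ - 1# → a ≡ 0p
  ^[p-1]≡-1⇒re≡0 p-prime 2<p {a} {b} β^[p-1]≡-1 with k , p≡2k+1 ← prime>2⇒odd p-prime 2<p =
    a+a≡0⇒a≡0 p-prime 2<p (begin
      a +p a           ≡⟨ cong (_+p a) (cong proj₁ β^p≡-β) ⟩
      (-p a) +p a      ≡⟨ -p-inverseˡ a ⟩
      0p               ∎)
    where
    β : Fp² p
    β = (a , b)
    β^p≡-β : (a , (n ^p k) *p b) ≡ - β
    β^p≡-β = begin
      (a , (n ^p k) *p b)    ≡⟨ frobenius-Fp² p-prime {k} p≡2k+1 a b ⟨
      β ^ p                  ≡⟨ cong (β ^_) (ℕ.m+[n∸m]≡n (ℕ.>-nonZero⁻¹ p)) ⟨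
      β * β ^ (p ∸ 1)        ≡⟨ cong (β *_) (trans (sym (^q≡^ β (p ∸ 1))) β^[p-1]≡-1) ⟩
      β * - 1#               ≡⟨ *-comm β (- 1#) ⟩
      - 1# * β               ≡⟨ -1*x≈-x β ⟩
      - β                    ∎

  Tr[b√n*x]≡0⇔im[x]≡0 : Prime p → 2 < p → n ≢ 0p → ∀ {b} → b ≢ 0p →
                         ∀ x → Tr n ((0p , b) * x) ≡ 0p ⇔ proj₂ x ≡ 0p
  Tr[b√n*x]≡0⇔im[x]≡0 p-prime 2<p n≢0 {b} b≢0 (c , e) = mk⇔ to from
    where
    re[b√n*x]≡nbe : (0p *p c) +p (n *p (b *p e)) ≡ n *p (b *p e)
    re[b√n*x]≡nbe = trans (cong (_+p (n *p (b *p e))) (*p-zeroˡ c)) (+p-identityˡ _)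
    to : Tr n ((0p , b) * (c , e)) ≡ 0p → e ≡ 0p
    to tr≡0 with a*b≡0⇒a≡0∨b≡0 p-prime (trans (sym re[b√n*x]≡nbe) (a+a≡0⇒a≡0 p-prime 2<p tr≡0))
    ... | inj₁ n≡0  = contradiction n≡0 n≢0
    ... | inj₂ be≡0 = Sum.[ (λ b≡0 → contradiction b≡0 b≢0) , (λ e≡0 → e≡0) ]′ (a*b≡0⇒a≡0∨b≡0 p-prime be≡0)
    from : e ≡ 0p → Tr n ((0p , b) * (c , e)) ≡ 0p
    from refl = begin
      Tr n ((0p , b) * (c , 0p))
        ≡⟨ cong (λ x → x +p x) (trans re[b√n*x]≡nbe (trans (cong (n *p_) (*p-zeroʳ b)) (*p-zeroʳ n))) ⟩
      0p +p 0p  ≡⟨ +p-identityˡ 0p ⟩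
      0p        ∎

  [0,b]²≡ι[nb²] : ∀ b → (0p , b) * (0p , b) ≡ ι n (n *p (b *p b))
  [0,b]²≡ι[nb²] b = cong₂ _,_
    (trans (cong (_+p (n *p (b *p b))) (*p-zeroˡ 0p)) (+p-identityˡ _))
    (trans (cong₂ _+p_ (*p-zeroˡ b) (*p-zeroʳ b)) (+p-identityˡ 0p))

module _ where
  open import Data.Nat using (_+_; _*_)

  [_] : ∀ {a} {A : Set a} → Dec A → ℕ
  [ a? ] = if does a? then 1 else 0

  []≡1 : ∀ {a} {A : Set a} (a? : Dec A) → A → [ a? ] ≡ 1
  []≡1 (yes _) _ = refl
  []≡1 (no ¬a) a = contradiction a ¬a

  []-⇔ : ∀ {a b} {A : Set a} {B : Set b} (a? : Dec A) (b? : Dec B) → A ⇔ B → [ a? ] ≡ [ b? ]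
  []-⇔ (yes _) (yes _) _   = refl
  []-⇔ (no _)  (no _)  _   = refl
  []-⇔ (yes a) (no ¬b) A⇔B = contradiction (Equivalence.to A⇔B a) ¬b
  []-⇔ (no ¬a) (yes b) A⇔B = contradiction (Equivalence.from A⇔B b) ¬a

  _≟²_ : ∀ {m k} (x y : Fin m × Fin k) → Dec (x ≡ y)
  _≟²_ = ≡-dec Fin._≟_ Fin._≟_

  ∑-const : ∀ m c → ∑[ i < m ] c ≡ m * c
  ∑-const zero    c = refl
  ∑-const (suc m) c = cong (c +_) (∑-const m c)

  ∑-mono : ∀ {m} {f g : Vector ℕ m} → (∀ i → f i ≤ g i) → sum f ≤ sum g
  ∑-mono {zero}  _   = z≤n
  ∑-mono {suc m} f≤g = ℕ.+-mono-≤ (f≤g zero) (∑-mono (f≤g ∘ suc))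

  ∑-[i≟j]*g≡g[i] : ∀ {m} (i : Fin m) (g : Vector ℕ m) → ∑[ j < m ] ([ i Fin.≟ j ] * g j) ≡ g i
  ∑-[i≟j]*g≡g[i] {suc m} zero    g =
    trans (cong₂ _+_ (ℕ.+-identityʳ (g zero)) (trans (∑-const m 0) (ℕ.*-zeroʳ m))) (ℕ.+-identityʳ (g zero))
  ∑-[i≟j]*g≡g[i] {suc m} (suc i) g = ∑-[i≟j]*g≡g[i] i (g ∘ suc)

  ∑-[i≟j]≡1 : ∀ {m} (i : Fin m) → ∑[ j < m ] [ i Fin.≟ j ] ≡ 1
  ∑-[i≟j]≡1 i = trans (sum-cong-≗ (λ j → sym (ℕ.*-identityʳ [ i Fin.≟ j ]))) (∑-[i≟j]*g≡g[i] i (λ _ → 1))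

  ∑-[j≟i]≡1 : ∀ {m} (i : Fin m) → ∑[ j < m ] [ j Fin.≟ i ] ≡ 1
  ∑-[j≟i]≡1 i = trans (sum-cong-≗ (λ j → []-⇔ (j Fin.≟ i) (i Fin.≟ j) (mk⇔ sym sym))) (∑-[i≟j]≡1 i)

  ∑-↑ : ∀ m {n} (f : Vector ℕ (m + n)) → sum f ≡ ∑[ i < m ] f (i ↑ˡ n) + ∑[ j < n ] f (m ↑ʳ j)
  ∑-↑ zero    f = refl
  ∑-↑ (suc m) f = trans (cong (f zero +_) (∑-↑ m (f ∘ suc))) (sym (ℕ.+-assoc (f zero) _ _))

  ∑-combine : ∀ m {k} (f : Vector ℕ (m * k)) → sum f ≡ ∑[ i < m ] ∑[ j < k ] f (combine i j)
  ∑-combine zero        f = refl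
  ∑-combine (suc m) {k} f = trans (∑-↑ k f) (cong (∑[ j < k ] f (j ↑ˡ (m * k)) +_) (∑-combine m (f ∘ (k ↑ʳ_))))

  module _ {m k : ℕ} where

    -- Summing along remQuot reduces sums over pairs to sums over Fin (m * k), where sum-permute applies.
    ∑² : (Fin m × Fin k → ℕ) → ℕ
    ∑² g = sum (g ∘ remQuot k)

    ∑²≡∑∑ : ∀ g → ∑² g ≡ ∑[ i < m ] ∑[ j < k ] g (i , j)
    ∑²≡∑∑ g = trans (∑-combine m (g ∘ remQuot k))
      (sum-cong-≗ (λ i → sum-cong-≗ (λ j → cong g (remQuot-combine i j))))

    ∑²-bijective : ∀ (σ : Fin m × Fin k → Fin m × Fin k) → Bijective _≡_ _≡_ σ → ∀ g → ∑² (g ∘ σ) ≡ ∑² g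
    ∑²-bijective σ σ-bij g = begin
      sum (g ∘ σ ∘ remQuot k)
        ≡⟨ sum-cong-≗ (λ l → cong g (remQuot-combine (proj₁ (σ (remQuot k l))) (proj₂ (σ (remQuot k l))))) ⟨
      sum (g ∘ remQuot k ∘ (π ⟨$⟩ʳ_))
        ≡⟨ sum-permute (g ∘ remQuot k) π ⟨
      sum (g ∘ remQuot k)
        ∎
      where
      open ≡-Reasoning
      π : Permutation (m * k) (m * k)
      π = ↔-sym *↔× ↔-∘ (⤖⇒↔ (mk⤖ σ-bij) ↔-∘ *↔×)

    ∑²-[≟²]≡1 : ∀ x → ∑² (λ y → [ y ≟² x ]) ≡ 1
    ∑²-[≟²]≡1 x = trans (sum-cong-≗ (λ l → []-⇔ (remQuot k l ≟² x) (uncurry combine x Fin.≟ l) (mk⇔ (to l) (from l))))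
      (∑-[i≟j]≡1 (uncurry combine x))
      where
      to : ∀ l → remQuot k l ≡ x → uncurry combine x ≡ l
      to l refl = combine-remQuot {m} k l
      from : ∀ l → uncurry combine x ≡ l → remQuot k l ≡ x
      from _ refl = remQuot-combine (proj₁ x) (proj₂ x)

    ∑²-[proj₁≟]≡k : ∀ c → ∑² (λ y → [ proj₁ y Fin.≟ c ]) ≡ k
    ∑²-[proj₁≟]≡k c = begin
      ∑² (λ y → [ proj₁ y Fin.≟ c ])      ≡⟨ ∑²≡∑∑ (λ y → [ proj₁ y Fin.≟ c ]) ⟩
      ∑[ i < m ] ∑[ j < k ] [ i Fin.≟ c ] ≡⟨ ∑-comm {m} {k} (λ i _ → [ i Fin.≟ c ]) ⟩
      ∑[ j < k ] ∑[ i < m ] [ i Fin.≟ c ] ≡⟨ sum-cong-≗ {k} (λ _ → ∑-[j≟i]≡1 c) ⟩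
      ∑[ j < k ] 1                        ≡⟨ ∑-const k 1 ⟩
      k * 1                               ≡⟨ ℕ.*-identityʳ k ⟩
      k                                   ∎
      where open ≡-Reasoning

    ∑²-[proj₂≟]≡m : ∀ c → ∑² (λ y → [ proj₂ y Fin.≟ c ]) ≡ m
    ∑²-[proj₂≟]≡m c = begin
      ∑² (λ y → [ proj₂ y Fin.≟ c ])      ≡⟨ ∑²≡∑∑ (λ y → [ proj₂ y Fin.≟ c ]) ⟩
      ∑[ i < m ] ∑[ j < k ] [ j Fin.≟ c ] ≡⟨ sum-cong-≗ {m} (λ _ → ∑-[j≟i]≡1 c) ⟩
      ∑[ i < m ] 1                        ≡⟨ ∑-const m 1 ⟩
      m * 1                               ≡⟨ ℕ.*-identityʳ m ⟩
      m                                   ∎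
      where open ≡-Reasoning

  fibreSize : ∀ {m k l} → (Fin m × Fin k → Fin l) → Fin l → ℕ
  fibreSize g v = ∑² (λ y → [ g y Fin.≟ v ])

  module _ {m k l : ℕ} (g : Fin m × Fin k → Fin l) where
    open ≡-Reasoning

    ∑-fibreSize : ∑[ v < l ] fibreSize g v ≡ m * k
    ∑-fibreSize = begin
      ∑[ v < l ] ∑² (λ y → [ g y Fin.≟ v ])   ≡⟨ ∑-comm (λ v i → [ g (remQuot k i) Fin.≟ v ]) ⟩
      ∑² (λ y → ∑[ v < l ] [ g y Fin.≟ v ])   ≡⟨ sum-cong-≗ (λ i → ∑-[i≟j]≡1 (g (remQuot k i))) ⟩
      ∑[ i < m * k ] 1                        ≡⟨ ∑-const (m * k) 1 ⟩
      m * k * 1                               ≡⟨ ℕ.*-identityʳ (m * k) ⟩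
      m * k                                   ∎

    ∑-fibreSize² : ∑[ v < l ] (fibreSize g v * fibreSize g v) ≡ ∑² (λ x → ∑² (λ y → [ g y Fin.≟ g x ]))
    ∑-fibreSize² = begin
      ∑[ v < l ] (fibreSize g v * fibreSize g v)
        ≡⟨ sum-cong-≗ (λ v → *-distribʳ-sum (fibreSize g v) (λ i → [ g (remQuot k i) Fin.≟ v ])) ⟩
      ∑[ v < l ] ∑² (λ x → [ g x Fin.≟ v ] * fibreSize g v)
        ≡⟨ ∑-comm (λ v i → [ g (remQuot k i) Fin.≟ v ] * fibreSize g v) ⟩
      ∑² (λ x → ∑[ v < l ] ([ g x Fin.≟ v ] * fibreSize g v))
        ≡⟨ sum-cong-≗ (λ i → ∑-[i≟j]*g≡g[i] (g (remQuot k i)) (fibreSize g)) ⟩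
      ∑² (λ x → fibreSize g (g x))
        ∎

  axes+point≤fibreSize : ∀ {q l} (g : Fin (suc q) × Fin (suc q) → Fin l) {v} →
                         (∀ i → g (i , 0F) ≡ v) → (∀ j → g (0F , j) ≡ v) →
                         ∀ {x₀} → proj₁ x₀ ≢ 0F → proj₂ x₀ ≢ 0F → g x₀ ≡ v →
                         2 * suc q ≤ fibreSize g v
  axes+point≤fibreSize {q} g {v} g-axis₁ g-axis₂ {x₀} x₀₁≢0 x₀₂≢0 gx₀≡v =
    subst (_≤ fibreSize g v) (cong (suc q +_) (sym (ℕ.+-identityʳ (suc q))))
      (ℕ.+-cancelʳ-≤ 1 _ _ (subst₂ _≤_ ∑Z≡2p+1 ∑W≡N+1 (∑-mono (pointwise ∘ rq))))
    where
    rq : Fin (suc q * suc q) → Fin (suc q) × Fin (suc q)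
    rq = remQuot {suc q} (suc q)
    -- Z counts both axes (the origin twice) and x₀; W counts the fibre and the origin once more.
    Z W : Fin (suc q) × Fin (suc q) → ℕ
    Z y = [ proj₁ y Fin.≟ 0F ] + [ proj₂ y Fin.≟ 0F ] + [ y ≟² x₀ ]
    W y = [ g y Fin.≟ v ] + [ y ≟² (0F , 0F) ]
    ∑Z≡2p+1 : ∑² Z ≡ suc q + suc q + 1
    ∑Z≡2p+1 = begin
      ∑² Z                   ≡⟨ ∑-distrib-+ (Z₁₂ ∘ rq) (Z₃ ∘ rq) ⟩
      ∑² Z₁₂ + ∑² Z₃         ≡⟨ cong (_+ ∑² Z₃) (∑-distrib-+ (Z₁ ∘ rq) (Z₂ ∘ rq)) ⟩
      ∑² Z₁ + ∑² Z₂ + ∑² Z₃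
        ≡⟨ cong₂ (λ a b → a + b + ∑² Z₃) (∑²-[proj₁≟]≡k {suc q} {suc q} 0F) (∑²-[proj₂≟]≡m {suc q} {suc q} 0F) ⟩
      suc q + suc q + ∑² Z₃  ≡⟨ cong (suc q + suc q +_) (∑²-[≟²]≡1 {suc q} {suc q} x₀) ⟩
      suc q + suc q + 1      ∎
      where
      open ≡-Reasoning
      Z₁ Z₂ Z₁₂ Z₃ : Fin (suc q) × Fin (suc q) → ℕ
      Z₁ y = [ proj₁ y Fin.≟ 0F ]
      Z₂ y = [ proj₂ y Fin.≟ 0F ]
      Z₁₂ y = Z₁ y + Z₂ y
      Z₃ y = [ y ≟² x₀ ]
    ∑W≡N+1 : ∑² W ≡ fibreSize g v + 1
    ∑W≡N+1 = trans (∑-distrib-+ (λ i → [ g (rq i) Fin.≟ v ]) (λ i → [ rq i ≟² (0F , 0F) ]))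
                   (cong (fibreSize g v +_) (∑²-[≟²]≡1 {suc q} {suc q} (0F , 0F)))
    pointwise : ∀ y → Z y ≤ W y
    pointwise (i , j) with i Fin.≟ 0F | j Fin.≟ 0F | (i , j) ≟² x₀ | g (i , j) Fin.≟ v | (i , j) ≟² (0F , 0F)
    ... | _        | yes refl | yes y≡x₀ | _      | _      = contradiction (sym (cong proj₂ y≡x₀)) x₀₂≢0
    ... | _        | yes refl | no _     | no g≢v | _      = contradiction (g-axis₁ i) g≢v
    ... | yes refl | yes refl | no _     | yes _  | yes _  = ℕ.≤-refl
    ... | yes refl | yes refl | no _     | yes _  | no ≢0  = contradiction refl ≢0
    ... | no i≢0   | yes refl | no _     | yes _  | yes ≡0 = contradiction (cong proj₁ ≡0) i≢0
    ... | no _     | yes refl | no _     | yes _  | no _   = ℕ.≤-refl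
    ... | yes refl | no _     | yes y≡x₀ | _      | _      = contradiction (sym (cong proj₁ y≡x₀)) x₀₁≢0
    ... | yes refl | no _     | no _     | yes _  | _      = s≤s z≤n
    ... | yes refl | no _     | no _     | no g≢v | _      = contradiction (g-axis₂ j) g≢v
    ... | no _     | no _     | yes _    | yes _  | _      = s≤s z≤n
    ... | no _     | no _     | yes y≡x₀ | no g≢v | _      = contradiction (trans (cong g y≡x₀) gx₀≡v) g≢v
    ... | no _     | no _     | no _     | _      | _      = z≤n

  private
    2ab≤a²+b²-≤ : ∀ {a b} → a ≤ b → 2 * (a * b) ≤ a * a + b * b
    2ab≤a²+b²-≤ {a} {b} a≤b = subst (λ b → 2 * (a * b) ≤ a * a + b * b) (ℕ.m+[n∸m]≡n a≤b)
      (subst (2 * (a * (a + c)) ≤_) (square a c) (ℕ.m≤m+n _ (c * c)))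
      where
      c : ℕ
      c = b ∸ a
      square : ∀ a c → 2 * (a * (a + c)) + c * c ≡ a * a + (a + c) * (a + c)
      square = solve-∀

  2ab≤a²+b² : ∀ a b → 2 * (a * b) ≤ a * a + b * b
  2ab≤a²+b² a b with ℕ.≤-total a b
  ... | inj₁ a≤b = 2ab≤a²+b²-≤ a≤b
  ... | inj₂ b≤a = subst₂ _≤_ (cong (2 *_) (ℕ.*-comm b a)) (ℕ.+-comm (b * b) (a * a)) (2ab≤a²+b²-≤ b≤a)

  private
    cauchy-schwarz-step : ∀ m a T Q → T * T ≤ m * Q → m * ((a + T) * (a + T)) ≤ m * (suc m * (a * a + Q))
    cauchy-schwarz-step m a T Q T²≤mQ = begin
      m * ((a + T) * (a + T))
        ≡⟨ expand m a T ⟩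
      m * (a * a) + 2 * ((m * a) * T) + m * (T * T)
        ≤⟨ ℕ.+-monoˡ-≤ (m * (T * T)) (ℕ.+-monoʳ-≤ (m * (a * a)) (2ab≤a²+b² (m * a) T)) ⟩
      m * (a * a) + ((m * a) * (m * a) + T * T) + m * (T * T)
        ≤⟨ ℕ.+-mono-≤ (ℕ.+-monoʳ-≤ (m * (a * a)) (ℕ.+-monoʳ-≤ ((m * a) * (m * a)) T²≤mQ)) (ℕ.*-monoʳ-≤ m T²≤mQ) ⟩
      m * (a * a) + ((m * a) * (m * a) + m * Q) + m * (m * Q)
        ≡⟨ collect m a Q ⟩
      m * (suc m * (a * a + Q))
        ∎
      where
      open ℕ.≤-Reasoning
      expand : ∀ m a T → m * ((a + T) * (a + T)) ≡ m * (a * a) + 2 * ((m * a) * T) + m * (T * T)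
      expand = solve-∀
      collect : ∀ m a Q → m * (a * a) + ((m * a) * (m * a) + m * Q) + m * (m * Q) ≡ m * (suc m * (a * a + Q))
      collect = solve-∀

  cauchy-schwarz : ∀ m (x : Vector ℕ m) → sum x * sum x ≤ m * ∑[ i < m ] (x i * x i)
  cauchy-schwarz zero            x = z≤n
  cauchy-schwarz (suc zero)      x = ℕ.≤-reflexive (one-term (x zero))
    where
    one-term : ∀ a → (a + 0) * (a + 0) ≡ 1 * (a * a + 0)
    one-term = solve-∀
  cauchy-schwarz (suc m@(suc _)) x = ℕ.*-cancelˡ-≤ m
    (cauchy-schwarz-step m (x zero) (sum (x ∘ suc)) _ (cauchy-schwarz m (x ∘ suc)))

  module _ (q : ℕ) where
    private
      p : ℕ
      p = suc q

    2p≤z⇒q²+2zp<z²+p² : ∀ {z} → 2 * p ≤ z → q * q + 2 * z * p < z * z + p * p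
    2p≤z⇒q²+2zp<z²+p² {z} 2p≤z = subst (λ z → q * q + 2 * z * p < z * z + p * p) (ℕ.m+[n∸m]≡n 2p≤z)
      (subst (q * q + 2 * (2 * p + k) * p <_) (sym (excess q k)) (ℕ.m<m+n _ ℕ.z<s))
      where
      k : ℕ
      k = z ∸ 2 * p
      excess : ∀ q k → (2 * suc q + k) * (2 * suc q + k) + suc q * suc q
                     ≡ q * q + 2 * (2 * suc q + k) * suc q + suc (2 * q + 2 * suc q * k + k * k)
      excess = solve-∀

    z²+p²≤q²+2zp⇒z<2p : ∀ {z} → z * z + p * p ≤ q * q + 2 * z * p → z < 2 * p
    z²+p²≤q²+2zp⇒z<2p {z} ineq = ℕ.≰⇒> (λ 2p≤z → ℕ.<⇒≱ (2p≤z⇒q²+2zp<z²+p² 2p≤z) ineq)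

    -- With T = p² - z the hypotheses amount to (z - p)² ≤ q², i.e. z ≤ p + q.
    fibre-bound : ∀ {z T Q} → z + T ≡ p * p → z * z + Q ≡ p * (p * p) + p * q → T * T ≤ q * Q → z < 2 * p
    fibre-bound {z} {T} {Q} z+T≡p² z²+Q≡p³+pq T²≤qQ =
      z²+p²≤q²+2zp⇒z<2p (ℕ.*-cancelˡ-≤ p (ℕ.+-cancelʳ-≤ (q * (p * (p * p))) _ _ (begin
        p * (z * z + p * p) + q * (p * (p * p))   ≡⟨ regroupˡ q z ⟩
        q * (z * z) + (p * p * (p * p) + z * z)   ≡⟨ cong (q * (z * z) +_) T²+2zp²≡p⁴+z² ⟨
        q * (z * z) + (T * T + 2 * z * (p * p))   ≡⟨ ℕ.+-assoc (q * (z * z)) (T * T) _ ⟨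
        q * (z * z) + T * T + 2 * z * (p * p)     ≤⟨ ℕ.+-monoˡ-≤ (2 * z * (p * p)) qz²+T²≤q[p³+pq] ⟩
        q * (p * (p * p) + p * q) + 2 * z * (p * p) ≡⟨ regroupʳ q z ⟩
        p * (q * q + 2 * z * p) + q * (p * (p * p)) ∎)))
      where
      open ℕ.≤-Reasoning
      qz²+T²≤q[p³+pq] : q * (z * z) + T * T ≤ q * (p * (p * p) + p * q)
      qz²+T²≤q[p³+pq] = begin
        q * (z * z) + T * T        ≤⟨ ℕ.+-monoʳ-≤ (q * (z * z)) T²≤qQ ⟩
        q * (z * z) + q * Q        ≡⟨ ℕ.*-distribˡ-+ q (z * z) Q ⟨
        q * (z * z + Q)            ≡⟨ cong (q *_) z²+Q≡p³+pq ⟩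
        q * (p * (p * p) + p * q)  ∎
      square : ∀ z T → T * T + 2 * z * (z + T) ≡ (z + T) * (z + T) + z * z
      square = solve-∀
      T²+2zp²≡p⁴+z² : T * T + 2 * z * (p * p) ≡ p * p * (p * p) + z * z
      T²+2zp²≡p⁴+z² = subst (λ s → T * T + 2 * z * s ≡ s * s + z * z) z+T≡p² (square z T)
      regroupˡ : ∀ q z → suc q * (z * z + suc q * suc q) + q * (suc q * (suc q * suc q))
                       ≡ q * (z * z) + (suc q * suc q * (suc q * suc q) + z * z)
      regroupˡ = solve-∀
      regroupʳ : ∀ q z → q * (suc q * (suc q * suc q) + suc q * q) + 2 * z * (suc q * suc q)
                       ≡ suc q * (q * q + 2 * z * suc q) + q * (suc q * (suc q * suc q))
      regroupʳ = solve-∀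

module _ {q : ℕ} (n : Fp (suc q)) (f : Fp² (suc q) → Fp² (suc q)) (f-planar : Planar n f) where
  open import Data.Nat using (_+_; _*_)
  open CommutativeRing (Fp²-commutativeRing n) using (+-identityʳ) renaming (_+_ to _+q′_; +-group to Fp²-+-group)
  open CommutativeRing (Fp-commutativeRing {suc q}) using () renaming (+-group to Fp-+-group)
  open ≡-Reasoning

  private
    p : ℕ
    p = suc q

    h : Fp² p → Fp p
    h = proj₂ ∘ f

  -- For a ≠ 0, h (x + a) ≡ h x iff the planar difference D x has second coordinate -h(a);
  -- D is a bijection, so that happens for exactly p points x.
  difference-collisions : ∀ a → ∑² (λ x → [ h (x +q′ a) Fin.≟ h x ]) ≡ p + [ a ≟² 0q n ] * (p * q)
  difference-collisions a with a ≟² 0q n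
  ... | yes refl = begin
    ∑² (λ x → [ h (x +q′ 0q n) Fin.≟ h x ])  ≡⟨ sum-cong-≗ ([h[x+0]≟h[x]]≡1 ∘ remQuot p) ⟩
    ∑[ i < p * p ] 1                         ≡⟨ ∑-const (p * p) 1 ⟩
    p * p * 1                                ≡⟨ p²≡p+pq q ⟩
    p + 1 * (p * q)                          ∎
    where
    [h[x+0]≟h[x]]≡1 : ∀ x → [ h (x +q′ 0q n) Fin.≟ h x ] ≡ 1
    [h[x+0]≟h[x]]≡1 x = []≡1 (h (x +q′ 0q n) Fin.≟ h x) (cong h (+-identityʳ x))
    p²≡p+pq : ∀ q → suc q * suc q * 1 ≡ suc q + 1 * (suc q * q)
    p²≡p+pq = solve-∀
  ... | no a≢0 = begin
    ∑² (λ x → [ h (x +q′ a) Fin.≟ h x ])   ≡⟨ sum-cong-≗ ([collision]≡[D≡c] ∘ remQuot p) ⟩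
    ∑² (λ x → [ proj₂ (D x) Fin.≟ c ])     ≡⟨ ∑²-bijective D (f-planar a a≢0) (λ y → [ proj₂ y Fin.≟ c ]) ⟩
    ∑² (λ y → [ proj₂ y Fin.≟ c ])         ≡⟨ ∑²-[proj₂≟]≡m c ⟩
    p                                      ≡⟨ ℕ.+-identityʳ p ⟨
    p + 0 * (p * q)                        ∎
    where
    D : Fp² p → Fp² p
    D x = _-q_ n (_-q_ n (f (x +q′ a)) (f x)) (f a)
    c : Fp p
    c = -p h a
    [collision]≡[D≡c] : ∀ x → [ h (x +q′ a) Fin.≟ h x ] ≡ [ proj₂ (D x) Fin.≟ c ]
    [collision]≡[D≡c] x = []-⇔ (h (x +q′ a) Fin.≟ h x) (proj₂ (D x) Fin.≟ c)
      (⇔-sym ([x∙y⁻¹]∙z⁻¹≈z⁻¹⇔x≈y Fp-+-group (h (x +q′ a)) (h x) (h a)))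

  planar-collisions : ∑² (λ x → ∑² (λ y → [ h y Fin.≟ h x ])) ≡ p * (p * p) + p * q
  planar-collisions = begin
    ∑² (λ x → ∑² (λ y → [ h y Fin.≟ h x ]))
      ≡⟨ sum-cong-≗ (translate ∘ remQuot p) ⟨
    ∑² (λ x → ∑² (λ a → [ h (x +q′ a) Fin.≟ h x ]))
      ≡⟨ ∑-comm (λ i j → [ h (remQuot p i +q′ remQuot p j) Fin.≟ h (remQuot p i) ]) ⟩
    ∑² (λ a → ∑² (λ x → [ h (x +q′ a) Fin.≟ h x ]))
      ≡⟨ sum-cong-≗ (λ j → difference-collisions (remQuot p j)) ⟩
    ∑² (λ a → p + [ a ≟² 0q n ] * (p * q))
      ≡⟨ ∑-distrib-+ (λ _ → p) (λ j → [ remQuot p j ≟² 0q n ] * (p * q)) ⟩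
    ∑[ i < p * p ] p + ∑² (λ a → [ a ≟² 0q n ] * (p * q))
      ≡⟨ cong₂ _+_ (∑-const (p * p) p) (sym (*-distribʳ-sum (p * q) (λ j → [ remQuot p j ≟² 0q n ]))) ⟩
    p * p * p + ∑² (λ a → [ a ≟² 0q n ]) * (p * q)
      ≡⟨ cong (λ k → p * p * p + k * (p * q)) (∑²-[≟²]≡1 (0q n)) ⟩
    p * p * p + 1 * (p * q)
      ≡⟨ regroup q ⟩
    p * (p * p) + p * q
      ∎
    where
    translate : ∀ x → ∑² (λ a → [ h (x +q′ a) Fin.≟ h x ]) ≡ ∑² (λ y → [ h y Fin.≟ h x ])
    translate x = ∑²-bijective (x +q′_) (∙-translation-bijective Fp²-+-group x) (λ y → [ h y Fin.≟ h x ])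
    regroup : ∀ q → suc q * suc q * suc q + 1 * (suc q * q) ≡ suc q * (suc q * suc q) + suc q * q
    regroup = solve-∀

  planar⇒fibreSize<2p : ∀ v → fibreSize h v < 2 * p
  planar⇒fibreSize<2p v = fibre-bound q z+T≡p² z²+Q≡p³+pq (cauchy-schwarz q (removeAt N v))
    where
    N : Fp p → ℕ
    N = fibreSize h
    z+T≡p² : N v + sum (removeAt N v) ≡ p * p
    z+T≡p² = trans (sym (sum-remove N)) (∑-fibreSize h)
    z²+Q≡p³+pq : N v * N v + sum (removeAt (λ w → N w * N w) v) ≡ p * (p * p) + p * q
    z²+Q≡p³+pq = trans (sym (sum-remove (λ w → N w * N w))) (trans (∑-fibreSize² h) planar-collisions)

module _ {r : ℕ} (p-prime : Prime (suc (suc r)))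
         (n : Fp (suc (suc r))) {b : Fp (suc (suc r))} (b≢0 : b ≢ 0p)
         (d : ℕ) (f : Fp² (suc (suc r)) → Fp² (suc (suc r)))
         (f-homogeneous : ∀ l x → f (_*q_ n (ι n l) x) ≡ _*q_ n (_^q_ n (ι n l) d) (f x))
         (f1≡1 : f (1q n) ≡ 1q n) (fβ≡β² : f (0p , b) ≡ _^q_ n (0p , b) 2) where
  open CommutativeRing (Fp²-commutativeRing n) using (_*_; 1#; *-comm; *-identityʳ)
  open ≡-Reasoning

  private
    β : Fp² (suc (suc r))
    β = 0p , b

    h : Fp² (suc (suc r)) → Fp (suc (suc r))
    h = proj₂ ∘ f

  ι[l]^d≡ι[l^d] : ∀ l → _^q_ n (ι n l) d ≡ ι n (l ^p d)
  ι[l]^d≡ι[l^d] l = trans (^q≡^ n (ι n l) d) (sym (ι-^ n l d))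

  f∘ι≡ι : ∀ l → f (ι n l) ≡ ι n (l ^p d)
  f∘ι≡ι l = begin
    f (ι n l)                   ≡⟨ cong f (*-identityʳ (ι n l)) ⟨
    f (ι n l * 1#)              ≡⟨ f-homogeneous l 1# ⟩
    _^q_ n (ι n l) d * f 1#     ≡⟨ cong₂ _*_ (ι[l]^d≡ι[l^d] l) f1≡1 ⟩
    ι n (l ^p d) * 1#           ≡⟨ *-identityʳ (ι n (l ^p d)) ⟩
    ι n (l ^p d)                ∎

  f[βι]≡ι : ∀ l → f (β * ι n l) ≡ ι n ((l ^p d) *p (n *p (b *p b)))
  f[βι]≡ι l = begin
    f (β * ι n l)                       ≡⟨ cong f (*-comm β (ι n l)) ⟩
    f (ι n l * β)                       ≡⟨ f-homogeneous l β ⟩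
    _^q_ n (ι n l) d * f β              ≡⟨ cong₂ _*_ (ι[l]^d≡ι[l^d] l) (trans fβ≡β² (cong (β *_) (*-identityʳ β))) ⟩
    ι n (l ^p d) * (β * β)              ≡⟨ cong (ι n (l ^p d) *_) ([0,b]²≡ι[nb²] n b) ⟩
    ι n (l ^p d) * ι n (n *p (b *p b))  ≡⟨ ι-* n (l ^p d) (n *p (b *p b)) ⟨
    ι n ((l ^p d) *p (n *p (b *p b)))   ∎

  β-line : ∀ e → ∃ λ l → (0p , e) ≡ β * ι n l
  β-line e with b⁻¹ , bb⁻¹≡1 ← *p-inverse p-prime b≢0 = b⁻¹ *p e , (begin
    (0p , e)                   ≡⟨ cong (0p ,_) (trans (sym (*p-identityˡ e)) (cong (_*p e) (sym bb⁻¹≡1))) ⟩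
    (0p , (b *p b⁻¹) *p e)     ≡⟨ cong (0p ,_) (*p-assoc b b⁻¹ e) ⟩
    (0p , b *p (b⁻¹ *p e))     ≡⟨ [0,b]*ι[l]≡[0,bl] n b (b⁻¹ *p e) ⟨
    β * ι n (b⁻¹ *p e)         ∎)

  h∘ι≡0 : ∀ c → h (ι n c) ≡ 0p
  h∘ι≡0 c = cong proj₂ (f∘ι≡ι c)

  h[βι]≡0 : ∀ l → h (β * ι n l) ≡ 0p
  h[βι]≡0 l = cong proj₂ (f[βι]≡ι l)

  h[0,e]≡0 : ∀ e → h (0p , e) ≡ 0p
  h[0,e]≡0 e with l , [0,e]≡βι ← β-line e = trans (cong h [0,e]≡βι) (h[βι]≡0 l)

  h≡0⇐ : ∀ {x} → InFpStar n x ⊎ InβFpStar n β x → h x ≡ 0p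
  h≡0⇐ (inj₁ (c , _ , refl)) = h∘ι≡0 c
  h≡0⇐ (inj₂ (l , _ , refl)) = h[βι]≡0 l

  h≡0⇒ : Planar n f → ∀ c e → (c , e) ≢ 0q n → h (c , e) ≡ 0p → InFpStar n (c , e) ⊎ InβFpStar n β (c , e)
  h≡0⇒ f-planar c e x≢0 hx≡0 with e Fin.≟ 0p | c Fin.≟ 0p
  ... | yes refl | _        = inj₁ (c , (λ c≡0 → x≢0 (cong (_, 0p) c≡0)) , refl)
  ... | no e≢0   | yes refl with l , [0,e]≡βι ← β-line e = inj₂ (l , l≢0 , [0,e]≡βι)
    where
    l≢0 : l ≢ 0p
    l≢0 refl = e≢0 (begin
      e                          ≡⟨ cong proj₂ [0,e]≡βι ⟩
      proj₂ (β * ι n 0p)         ≡⟨ cong proj₂ ([0,b]*ι[l]≡[0,bl] n b 0p) ⟩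
      b *p 0p                    ≡⟨ CommutativeRing.zeroʳ Fp-commutativeRing b ⟩
      0p                         ∎)
  ... | no e≢0   | no c≢0   = contradiction (planar⇒fibreSize<2p n f f-planar 0p)
                                 (ℕ.≤⇒≯ (axes+point≤fibreSize h h∘ι≡0 h[0,e]≡0 c≢0 e≢0 hx≡0))

  Tr[βf]≡0⇔ : Planar n f → n ≢ 0p → 2 < suc (suc r) →
              ∀ x → x ≢ 0q n → Tr n (β * f x) ≡ 0p ⇔ (InFpStar n x ⊎ InβFpStar n β x)
  Tr[βf]≡0⇔ f-planar n≢0 2<p x@(c , e) x≢0 =
    mk⇔ (h≡0⇒ f-planar c e x≢0) h≡0⇐ ⇔-∘ Tr[b√n*x]≡0⇔im[x]≡0 n p-prime 2<p n≢0 b≢0 (f x)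

lemma2p5 : (p : ℕ) .{{_ : NonZero p}} → Prime p → 11 ≤ p →
    (n : Fp p) → NonSquare n →
    (β : Fp² p) → β ≢ 0q n → _^q_ n β (p ∸ 1) ≡ -q_ n (1q n) →
    (γ : Fp² p) → Primitive n γ →
    (d : ℕ) → 1 ≤ d →
    (f : Fp² p → Fp² p) → Planar n f →
    (∀ (l : Fp p) (x : Fp² p) → f (_*q_ n (ι n l) x) ≡ _*q_ n (_^q_ n (ι n l) d) (f x)) →
    f (1q n) ≡ 1q n → f β ≡ _^q_ n β 2 → f γ ≡ _^q_ n γ 2 →
    ∀ (x : Fp² p) → x ≢ 0q n →
      (Tr n (_*q_ n β (f x)) ≡ 0p) ⇔ (InFpStar n x ⊎ InβFpStar n β x)
lemma2p5 (suc (suc r)) p-prime 11≤p n n-nonSquare (a , b) β≢0 β^[p-1]≡-1 _ _ d _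
         f f-planar f-homogeneous f1≡1 fβ≡β² _ x x≢0 =
  subst (λ a → Tr n (_*q_ n (a , b) (f x)) ≡ 0p ⇔ (InFpStar n x ⊎ InβFpStar n (a , b) x)) (sym a≡0)
    (Tr[βf]≡0⇔ p-prime n b≢0 d f f-homogeneous f1≡1 (subst (λ a → f (a , b) ≡ _^q_ n (a , b) 2) a≡0 fβ≡β²)
               f-planar (nonSquare⇒≢0 n-nonSquare) 2<p x x≢0)
  where
  2<p : 2 < suc (suc r)
  2<p = ℕ.≤-trans (s≤s (s≤s (s≤s z≤n))) 11≤p
  a≡0 : a ≡ 0p
  a≡0 = ^[p-1]≡-1⇒re≡0 n p-prime 2<p β^[p-1]≡-1
  b≢0 : b ≢ 0p
  b≢0 b≡0 = β≢0 (cong₂ _,_ a≡0 b≡0)
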